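{- Let $A$ and $B$ be point configurations. Then $\deg(A*B)=\deg(A)+\deg(B)$ and $\operatorname{codeg}(A*B)=\operatorname{codeg}(A)+\operatorname{codeg}(B)$.
   Context: A point configuration is a finite family of points in some $\mathbb{R}^k$ (repetitions allowed; cardinalities count multiplicities); its dimension $\dim A$ is the dimension of its affine span. The codegree $\operatorname{codeg}(A)$ is the minimum cardinality of a subfamily $S\subseteq A$ whose convex hull meets the relative interior of $\operatorname{conv}(A)$, and the degree is $\deg(A)=\dim A+1-\operatorname{codeg}(A)$. For $A\subset\mathbb{R}^p$ and $B\subset\mathbb{R}^q$, the join is $A*B=\{(a,0,0):a\in A\}\cup\{(0,b,1):b\in B\}\subset\mathbb{R}^{p+q+1}$ (assuming, after translation, that affine spans are in general position so that $\dim(A*B)=\dim A+\dim B+1$). -}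

module Defs where

open import Level using (Level; _⊔_) renaming (suc to lsuc)
open import Data.Nat using (ℕ; zero; suc) renaming (_+_ to _+ℕ_; _≤_ to _≤ℕ_)
open import Data.Integer as ℤ using (ℤ; +_; _-_)
open import Data.Fin using (Fin; splitAt)
import Data.Fin as Fin
open import Relation.Binary.PropositionalEquality using (_≡_)
open import Data.Fin.Subset using (Subset; _∉_; ∣_∣; ⊤)
open import Data.Sum using (_⊎_; inj₁; inj₂)
open import Data.Product using (Σ; ∃; _×_; _,_)
open import Relation.Nullary using (¬_)
open import Relation.Binary.Core using (Rel)
open import Relation.Binary.Structures using (IsStrictPartialOrder)
open import Algebra.Structures using (IsCommutativeRing)

-- Ordered fields (classical axioms). Points live in F^k for an arbitrary
-- ordered field F; ℝ is the case of the paper.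

record OrderedField (c ℓ₁ ℓ₂ : Level) : Set (lsuc (c ⊔ ℓ₁ ⊔ ℓ₂)) where
  infixl 6 _+_
  infixl 7 _*_
  infix  4 _≈_ _<_
  field
    Carrier : Set c
    _≈_     : Rel Carrier ℓ₁
    _+_     : Carrier → Carrier → Carrier
    _*_     : Carrier → Carrier → Carrier
    -_      : Carrier → Carrier
    0#      : Carrier
    1#      : Carrier
    isCommutativeRing : IsCommutativeRing _≈_ _+_ _*_ -_ 0# 1#
    inverse : ∀ x → ¬ (x ≈ 0#) → ∃ λ y → x * y ≈ 1#
    _<_     : Rel Carrier ℓ₂
    isStrictPartialOrder : IsStrictPartialOrder _≈_ _<_
    trichotomy : ∀ x y → x < y ⊎ (x ≈ y ⊎ y < x)
    +-mono-< : ∀ {x y} z → x < y → x + z < y + z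
    *-pos    : ∀ {x y} → 0# < x → 0# < y → 0# < x * y
    0<1      : 0# < 1#

  _≤_ : Carrier → Carrier → Set (ℓ₁ ⊔ ℓ₂)
  x ≤ y = x < y ⊎ x ≈ y

module Geometry {c ℓ₁ ℓ₂} (F : OrderedField c ℓ₁ ℓ₂) where
  open OrderedField F hiding (_≤_)
  _≤ᶠ_ = OrderedField._≤_ F

  Point : ℕ → Set c
  Point k = Fin k → Carrier

  Config : ℕ → ℕ → Set c
  Config k n = Fin n → Point k

  Σ⟨_⟩ : ∀ {n} → (Fin n → Carrier) → Carrier
  Σ⟨_⟩ {zero}  f = 0#
  Σ⟨_⟩ {suc n} f = f Fin.zero + Σ⟨ (λ i → f (Fin.suc i)) ⟩

  _≈ᵖ_ : ∀ {k} → Point k → Point k → Set ℓ₁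
  x ≈ᵖ y = ∀ t → x t ≈ y t

  AffinelyIndependent : ∀ {k r} → (Fin r → Point k) → Set (c ⊔ ℓ₁)
  AffinelyIndependent {k} {r} P =
    (λ′ : Fin r → Carrier) → Σ⟨ λ′ ⟩ ≈ 0# →
    (∀ t → Σ⟨ (λ j → λ′ j * P j t) ⟩ ≈ 0#) → ∀ j → λ′ j ≈ 0#

  -- dim A = d : the affine span of A has dimension d, i.e. A contains
  -- d+1 affinely independent members but no d+2.
  IsDim : ∀ {k n} → Config k n → ℕ → Set (c ⊔ ℓ₁)
  IsDim {k} {n} A d =
    (Σ (Fin (suc d) → Fin n) λ f → AffinelyIndependent (λ j → A (f j)))
    × ((g : Fin (suc (suc d)) → Fin n) → ¬ AffinelyIndependent (λ j → A (g j)))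

  InConvSub : ∀ {k n} → Config k n → Subset n → Point k → Set (c ⊔ ℓ₁ ⊔ ℓ₂)
  InConvSub {k} {n} A S x = Σ (Fin n → Carrier) λ w →
    (∀ i → 0# ≤ᶠ w i) × (∀ i → i ∉ S → w i ≈ 0#) × (Σ⟨ w ⟩ ≈ 1#)
    × (x ≈ᵖ (λ t → Σ⟨ (λ i → w i * A i t) ⟩))

  InConv : ∀ {k n} → Config k n → Point k → Set (c ⊔ ℓ₁ ⊔ ℓ₂)
  InConv A = InConvSub A ⊤

  -- relative interior of the convex set conv(A):
  -- x ∈ conv A and every segment [y,x] in conv A extends beyond x
  -- (Rockafellar, Convex Analysis, Thm. 6.4).
  InRelint : ∀ {k n} → Config k n → Point k → Set (c ⊔ ℓ₁ ⊔ ℓ₂)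
  InRelint A x = InConv A x × (∀ y → InConv A y →
    Σ Carrier λ μ → (0# < μ) × InConv A (λ t → x t + μ * (x t + - y t)))

  MeetsRelint : ∀ {k n} → Config k n → Subset n → Set (c ⊔ ℓ₁ ⊔ ℓ₂)
  MeetsRelint A S = Σ (Point _) λ x → InConvSub A S x × InRelint A x

  IsCodeg : ∀ {k n} → Config k n → ℕ → Set (c ⊔ ℓ₁ ⊔ ℓ₂)
  IsCodeg {k} {n} A m =
    (Σ (Subset n) λ S → (∣ S ∣ ≡ m) × MeetsRelint A S)
    × ((S : Subset n) → MeetsRelint A S → m ≤ℕ ∣ S ∣)

  -- deg = dim + 1 - codeg
  degree : ℕ → ℕ → ℤ
  degree d m = + (suc d) - + m

  -- the join A * B ⊂ F^(p+q+1): (a,0,0) and (0,b,1)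
  join : ∀ {p q n m} → Config p n → Config q m → Config (p +ℕ q +ℕ 1) (n +ℕ m)
  join {p} {q} {n} {m} A B i t with splitAt n i | splitAt (p +ℕ q) t
  ... | inj₁ a | inj₁ s with splitAt p s
  ...   | inj₁ u = A a u
  ...   | inj₂ _ = 0#
  join {p} {q} {n} {m} A B i t | inj₁ a | inj₂ _ = 0#
  join {p} {q} {n} {m} A B i t | inj₂ b | inj₁ s with splitAt p s
  ...   | inj₁ _ = 0#
  ...   | inj₂ v = B b v
  join {p} {q} {n} {m} A B i t | inj₂ b | inj₂ _ = 1#

{-# OPTIONS --safe #-}
module Submission where

-- The last coordinate of A * B is 0 on A and 1 on B. Hence an affine dependence of points of A * B
-- has zero total weight on its A-part and on its B-part separately, so it splits into affine
-- dependences of A and of B: joins of independent families are independent, while by pigeonhole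
-- any dim A + dim B + 3 points of A * B contain dim A + 2 points of A or dim B + 2 points of B.
-- A point lies in relint conv(X) iff it is a convex combination of X with all weights positive, so S
-- meets relint conv(X) iff some nonnegative weights on S and some positive weights on X have equal
-- total mass and equal weighted sum. Such certificates for A and B concatenate to one for A * B, and
-- one for A * B restricts to both parts, since the last coordinate forces equal masses on B and
-- hence on A. The degree is then additive because dim + 1 and codeg are.

open import Defs
open import Level using (Level; _⊔_)
open import Function using (_∘_)
open import Function.Definitions using (Injective)
open import Data.Nat using (ℕ; zero; suc) renaming (_+_ to _+ℕ_)
import Data.Nat as ℕ
import Data.Nat.Properties as ℕ
open import Data.Integer using (ℤ) renaming (_+_ to _+ℤ_)
import Data.Integer as ℤ
import Data.Integer.Properties as ℤ
open import Data.Integer.Solver using (module +-*-Solver)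
open import Data.Fin as Fin using (Fin; _↑ˡ_; _↑ʳ_; splitAt)
import Data.Fin.Properties as Fin
open import Data.Fin.Subset using (Subset; _∈_; _∉_; ∣_∣; inside; outside)
open import Data.Fin.Subset.Properties using (∈⊤)
open import Data.Vec as Vec using (_++_)
import Data.Vec.Properties as Vec
import Data.Vec.Functional as VF
import Data.Vec.Functional.Properties as VF
open import Data.Sum as Sum using (_⊎_; inj₁; inj₂)
open import Data.Product as Product using (Σ; ∃; _×_; _,_; proj₁; proj₂)
open import Data.Empty using (⊥-elim)
open import Relation.Nullary using (¬_; yes; no)
open import Relation.Binary.PropositionalEquality as ≡ using (_≡_; _≢_)
open import Relation.Binary.Bundles using (StrictPartialOrder)
open import Relation.Binary.Structures using (IsStrictPartialOrder)
open import Algebra.Bundles using (CommutativeRing)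
open import Algebra.Structures using (IsCommutativeRing)
import Relation.Binary.Construct.StrictToNonStrict as NonStrict
import Relation.Binary.Reasoning.Setoid as SetoidReasoning
import Relation.Binary.Reasoning.StrictPartialOrder as StrictPartialOrderReasoning

↑ˡ⊎↑ʳ : ∀ {a b} (i : Fin (a +ℕ b)) → (Σ (Fin a) λ x → i ≡ x ↑ˡ b) ⊎ (Σ (Fin b) λ y → i ≡ a ↑ʳ y)
↑ˡ⊎↑ʳ {a} i with splitAt a i in eq
... | inj₁ x = inj₁ (x , ≡.sym (Fin.splitAt⁻¹-↑ˡ eq))
... | inj₂ y = inj₂ (y , ≡.sym (Fin.splitAt⁻¹-↑ʳ eq))

record Selection {X Z : Set} {K} (G : Fin K → Z) (f : X → Z) (r : ℕ) : Set where
  constructor selection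
  field
    index           : Fin r → Fin K
    index-injective : Injective _≡_ _≡_ index
    value           : Fin r → X
    G∘index≡f∘value : ∀ j → G (index j) ≡ f (value j)

selection-[] : ∀ {X Z : Set} {K} {G : Fin K → Z} {f : X → Z} → Selection G f 0
selection-[] = selection (λ ()) (λ { {()} }) (λ ()) (λ ())

module _ {X Z : Set} {K} {G : Fin (suc K) → Z} {f : X → Z} where

  selection-∷ : ∀ {x r} → G Fin.zero ≡ f x → Selection (G ∘ Fin.suc) f r → Selection G f (suc r)
  selection-∷ {x} {r} G₀≡fx (selection ι ι-inj xs Gι≡fxs) = selection ι′ ι′-inj xs′ Gι′≡fxs′
    where
    ι′ : Fin (suc r) → Fin (suc K)
    ι′ Fin.zero    = Fin.zero
    ι′ (Fin.suc j) = Fin.suc (ι j)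
    ι′-inj : Injective _≡_ _≡_ ι′
    ι′-inj {Fin.zero}  {Fin.zero}  _ = ≡.refl
    ι′-inj {Fin.suc i} {Fin.suc j} e = ≡.cong Fin.suc (ι-inj (Fin.suc-injective e))
    xs′ : Fin (suc r) → X
    xs′ Fin.zero    = x
    xs′ (Fin.suc j) = xs j
    Gι′≡fxs′ : ∀ j → G (ι′ j) ≡ f (xs′ j)
    Gι′≡fxs′ Fin.zero    = G₀≡fx
    Gι′≡fxs′ (Fin.suc j) = Gι≡fxs j

  selection-suc : ∀ {r} → Selection (G ∘ Fin.suc) f r → Selection G f r
  selection-suc (selection ι ι-inj xs Gι≡fxs) = selection (Fin.suc ∘ ι) (ι-inj ∘ Fin.suc-injective) xs Gι≡fxs

pigeonhole-⊎ : ∀ {X Y : Set} {K} a b (G : Fin K → X ⊎ Y) → suc (a +ℕ b) ℕ.≤ K →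
  Selection G inj₁ (suc a) ⊎ Selection G inj₂ (suc b)
pigeonhole-⊎ {K = suc K} a b G (ℕ.s≤s a+b<K) with G Fin.zero in G₀≡
pigeonhole-⊎ {K = suc K} zero b G _ | inj₁ x = inj₁ (selection-∷ G₀≡ selection-[])
pigeonhole-⊎ {K = suc K} (suc a) b G (ℕ.s≤s a+b<K) | inj₁ x =
  Sum.map (selection-∷ G₀≡) selection-suc (pigeonhole-⊎ a b (G ∘ Fin.suc) a+b<K)
pigeonhole-⊎ {K = suc K} a zero G _ | inj₂ y = inj₂ (selection-∷ G₀≡ selection-[])
pigeonhole-⊎ {K = suc K} a (suc b) G (ℕ.s≤s a+b<K) | inj₂ y =
  Sum.map selection-suc (selection-∷ G₀≡) (pigeonhole-⊎ a b (G ∘ Fin.suc) (≡.subst (ℕ._≤ K) (ℕ.+-suc a b) a+b<K))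

∣p++q∣≡∣p∣+∣q∣ : ∀ {n m} (p : Subset n) (q : Subset m) → ∣ p ++ q ∣ ≡ ∣ p ∣ +ℕ ∣ q ∣
∣p++q∣≡∣p∣+∣q∣ Vec.[]            q = ≡.refl
∣p++q∣≡∣p∣+∣q∣ (inside Vec.∷ p)  q = ≡.cong suc (∣p++q∣≡∣p∣+∣q∣ p q)
∣p++q∣≡∣p∣+∣q∣ (outside Vec.∷ p) q = ∣p++q∣≡∣p∣+∣q∣ p q

module _ {n m} (p : Subset n) (q : Subset m) where

  x∈p⇒x↑ˡ∈p++q : ∀ {x} → x ∈ p → x ↑ˡ m ∈ p ++ q
  x∈p⇒x↑ˡ∈p++q {x} x∈p = Vec.lookup⇒[]= _ _ (≡.trans (Vec.lookup-++ˡ p q x) (Vec.[]=⇒lookup x∈p))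

  x↑ˡ∈p++q⇒x∈p : ∀ {x} → x ↑ˡ m ∈ p ++ q → x ∈ p
  x↑ˡ∈p++q⇒x∈p {x} x∈ = Vec.lookup⇒[]= _ _ (≡.trans (≡.sym (Vec.lookup-++ˡ p q x)) (Vec.[]=⇒lookup x∈))

  y∈q⇒n↑ʳy∈p++q : ∀ {y} → y ∈ q → n ↑ʳ y ∈ p ++ q
  y∈q⇒n↑ʳy∈p++q {y} y∈q = Vec.lookup⇒[]= _ _ (≡.trans (Vec.lookup-++ʳ p q y) (Vec.[]=⇒lookup y∈q))

  n↑ʳy∈p++q⇒y∈q : ∀ {y} → n ↑ʳ y ∈ p ++ q → y ∈ q
  n↑ʳy∈p++q⇒y∈q {y} y∈ = Vec.lookup⇒[]= _ _ (≡.trans (≡.sym (Vec.lookup-++ʳ p q y)) (Vec.[]=⇒lookup y∈))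

++⁺ : ∀ {a ℓ} {X : Set a} (P : X → Set ℓ) {n m} {xs : Fin n → X} {ys : Fin m → X} →
  (∀ i → P (xs i)) → (∀ j → P (ys j)) → ∀ i → P ((xs VF.++ ys) i)
++⁺ P {n} Pxs Pys i with splitAt n i
... | inj₁ a = Pxs a
... | inj₂ b = Pys b

+[m+n]-+[k+l]≡[+m-+k]+[+n-+l] : ∀ m n k l →
  ℤ.+ (m +ℕ n) ℤ.- ℤ.+ (k +ℕ l) ≡ (ℤ.+ m ℤ.- ℤ.+ k) +ℤ (ℤ.+ n ℤ.- ℤ.+ l)
+[m+n]-+[k+l]≡[+m-+k]+[+n-+l] m n k l rewrite ℤ.pos-+ m n | ℤ.pos-+ k l =
  solve 4 (λ m n k l → (m :+ n) :- (k :+ l) := (m :- k) :+ (n :- l)) ≡.refl (ℤ.+ m) (ℤ.+ n) (ℤ.+ k) (ℤ.+ l)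
  where open +-*-Solver

module _ {c ℓ₁ ℓ₂} (F : OrderedField c ℓ₁ ℓ₂) where
  open OrderedField F hiding (_≤_)
  open Geometry F
  open IsCommutativeRing isCommutativeRing
  open IsStrictPartialOrder isStrictPartialOrder
    using (irrefl; <-respˡ-≈; <-respʳ-≈)

  commutativeRing : CommutativeRing c ℓ₁
  commutativeRing = record { isCommutativeRing = isCommutativeRing }

  open CommutativeRing commutativeRing using (ring; semiring; commutativeSemiring; +-abelianGroup)
  open import Algebra.Properties.Ring ring using (-‿distribˡ-*; -‿distribʳ-*)
  open import Algebra.Properties.AbelianGroup +-abelianGroup using (⁻¹-∙-comm; ε⁻¹≈ε; ∙-cancelʳ)
  open import Algebra.Properties.Semiring.Sum semiring
    using (sum; sum-cong-≋; sum-replicate-zero; ∑-distrib-+; ∑-comm; *-distribˡ-sum; *-distribʳ-sum)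
  open import Algebra.Solver.Ring.NaturalCoefficients.Default commutativeSemiring
    using (solve; _:+_; _:*_; _:=_; con)
  module ≈-Reasoning = SetoidReasoning setoid

  strictPartialOrder : StrictPartialOrder c ℓ₁ ℓ₂
  strictPartialOrder = record { isStrictPartialOrder = isStrictPartialOrder }

  module ≤-Reasoning = StrictPartialOrderReasoning strictPartialOrder

  infix 4 _≤_
  _≤_ : Carrier → Carrier → Set (ℓ₁ ⊔ ℓ₂)
  _≤_ = _≤ᶠ_

  ≤-respˡ-≈ : ∀ {x x′ y} → x ≈ x′ → x ≤ y → x′ ≤ y
  ≤-respˡ-≈ = NonStrict.≤-respˡ-≈ _≈_ _<_ sym trans <-respˡ-≈

  ≤-respʳ-≈ : ∀ {x y y′} → y ≈ y′ → x ≤ y → x ≤ y′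
  ≤-respʳ-≈ = NonStrict.≤-respʳ-≈ _≈_ _<_ trans <-respʳ-≈

  +-monoˡ-≤ : ∀ z {x y} → x ≤ y → x + z ≤ y + z
  +-monoˡ-≤ z (inj₁ x<y) = inj₁ (+-mono-< z x<y)
  +-monoˡ-≤ z (inj₂ x≈y) = inj₂ (+-congʳ x≈y)

  +-monoʳ-≤ : ∀ z {x y} → x ≤ y → z + x ≤ z + y
  +-monoʳ-≤ z {x} {y} x≤y = ≤-respʳ-≈ (+-comm y z) (≤-respˡ-≈ (+-comm x z) (+-monoˡ-≤ z x≤y))

  x≤x+y : ∀ {x y} → 0# ≤ y → x ≤ x + y
  x≤x+y {x} 0≤y = ≤-respˡ-≈ (+-identityʳ x) (+-monoʳ-≤ x 0≤y)

  +-nonneg : ∀ {x y} → 0# ≤ x → 0# ≤ y → 0# ≤ x + y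
  +-nonneg {x} {y} 0≤x 0≤y = begin
    0#      ≤⟨ 0≤x ⟩
    x       ≤⟨ x≤x+y 0≤y ⟩
    x + y   ∎
    where open ≤-Reasoning

  +-pos : ∀ {x y} → 0# < x → 0# ≤ y → 0# < x + y
  +-pos {x} {y} 0<x 0≤y = begin-strict
    0#      <⟨ 0<x ⟩
    x       ≤⟨ x≤x+y 0≤y ⟩
    x + y   ∎
    where open ≤-Reasoning

  *-nonneg : ∀ {x y} → 0# ≤ x → 0# ≤ y → 0# ≤ x * y
  *-nonneg (inj₁ 0<x) (inj₁ 0<y) = inj₁ (*-pos 0<x 0<y)
  *-nonneg {x} {y} (inj₂ 0≈x) _  = inj₂ (sym (trans (*-congʳ (sym 0≈x)) (zeroˡ y)))
  *-nonneg {x} {y} _ (inj₂ 0≈y)  = inj₂ (sym (trans (*-congˡ (sym 0≈y)) (zeroʳ x)))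

  x≤y⇒0≤y-x : ∀ {x y} → x ≤ y → 0# ≤ y + - x
  x≤y⇒0≤y-x {x} x≤y = ≤-respˡ-≈ (-‿inverseʳ x) (+-monoˡ-≤ (- x) x≤y)

  0≤y-x⇒x≤y : ∀ {x y} → 0# ≤ y + - x → x ≤ y
  0≤y-x⇒x≤y {x} {y} 0≤y-x = ≤-respˡ-≈ (+-identityˡ x) (≤-respʳ-≈ y-x+x≈y (+-monoˡ-≤ x 0≤y-x))
    where
    y-x+x≈y : y + - x + x ≈ y
    y-x+x≈y = trans (+-assoc y (- x) x) (trans (+-congˡ (-‿inverseˡ x)) (+-identityʳ y))

  *-monoˡ-≤ : ∀ {z x y} → 0# ≤ z → x ≤ y → z * x ≤ z * y
  *-monoˡ-≤ {z} {x} {y} 0≤z x≤y = 0≤y-x⇒x≤y (≤-respʳ-≈ z[y-x]≈zy-zx (*-nonneg 0≤z (x≤y⇒0≤y-x x≤y)))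
    where
    z[y-x]≈zy-zx : z * (y + - x) ≈ z * y + - (z * x)
    z[y-x]≈zy-zx = trans (distribˡ z y (- x)) (+-congˡ (sym (-‿distribʳ-* z x)))

  inverse-pos : ∀ {x} → 0# < x → ∃ λ r → x * r ≈ 1# × 0# < r
  inverse-pos {x} 0<x with inverse x (λ x≈0 → irrefl refl (<-respʳ-≈ x≈0 0<x))
  ... | r , xr≈1 with trichotomy 0# r
  ...   | inj₁ 0<r = r , xr≈1 , 0<r
  ...   | inj₂ (inj₁ 0≈r) = ⊥-elim (irrefl refl (<-respʳ-≈ 1≈0 0<1))
    where
    1≈0 : 1# ≈ 0#
    1≈0 = trans (sym xr≈1) (trans (*-congˡ (sym 0≈r)) (zeroʳ x))
  ...   | inj₂ (inj₂ r<0) = ⊥-elim (irrefl refl (<-respʳ-≈ (-‿inverseˡ 1#) 0<-1+1))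
    where
    0<-r : 0# < - r
    0<-r = <-respˡ-≈ (-‿inverseʳ r) (<-respʳ-≈ (+-identityˡ (- r)) (+-mono-< (- r) r<0))
    0<-1+1 : 0# < - 1# + 1#
    0<-1+1 = +-pos (<-respʳ-≈ (trans (sym (-‿distribʳ-* x r)) (-‿cong xr≈1)) (*-pos 0<x 0<-r)) (inj₁ 0<1)

  Σ≡sum : ∀ {n} (f : Fin n → Carrier) → Σ⟨ f ⟩ ≡ sum f
  Σ≡sum {zero}  f = ≡.refl
  Σ≡sum {suc n} f = ≡.cong (f Fin.zero +_) (Σ≡sum (f ∘ Fin.suc))

  Σ-cong : ∀ {n} {f g : Fin n → Carrier} → (∀ i → f i ≈ g i) → Σ⟨ f ⟩ ≈ Σ⟨ g ⟩
  Σ-cong {f = f} {g} f≈g rewrite Σ≡sum f | Σ≡sum g = sum-cong-≋ f≈g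

  Σ-distrib-+ : ∀ {n} (f g : Fin n → Carrier) → Σ⟨ (λ i → f i + g i) ⟩ ≈ Σ⟨ f ⟩ + Σ⟨ g ⟩
  Σ-distrib-+ f g rewrite Σ≡sum (λ i → f i + g i) | Σ≡sum f | Σ≡sum g = ∑-distrib-+ f g

  *-distribˡ-Σ : ∀ {n} x (f : Fin n → Carrier) → x * Σ⟨ f ⟩ ≈ Σ⟨ (λ i → x * f i) ⟩
  *-distribˡ-Σ x f rewrite Σ≡sum f | Σ≡sum (λ i → x * f i) = *-distribˡ-sum x f

  *-distribʳ-Σ : ∀ {n} x (f : Fin n → Carrier) → Σ⟨ f ⟩ * x ≈ Σ⟨ (λ i → f i * x) ⟩
  *-distribʳ-Σ x f rewrite Σ≡sum f | Σ≡sum (λ i → f i * x) = *-distribʳ-sum x f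

  Σ-zero : ∀ n → Σ⟨ (λ (_ : Fin n) → 0#) ⟩ ≈ 0#
  Σ-zero n rewrite Σ≡sum {n} (λ _ → 0#) = sum-replicate-zero n

  Σ-comm : ∀ {n m} (f : Fin n → Fin m → Carrier) →
    Σ⟨ (λ i → Σ⟨ f i ⟩) ⟩ ≈ Σ⟨ (λ j → Σ⟨ (λ i → f i j) ⟩) ⟩
  Σ-comm f = begin
    Σ⟨ (λ i → Σ⟨ f i ⟩) ⟩              ≈⟨ Σ-cong (λ i → reflexive (Σ≡sum (f i))) ⟩
    Σ⟨ (λ i → sum (f i)) ⟩             ≡⟨ Σ≡sum (λ i → sum (f i)) ⟩
    sum (λ i → sum (f i))              ≈⟨ ∑-comm f ⟩
    sum (λ j → sum (λ i → f i j))      ≡⟨ Σ≡sum (λ j → sum (λ i → f i j)) ⟨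
    Σ⟨ (λ j → sum (λ i → f i j)) ⟩     ≈⟨ Σ-cong (λ j → reflexive (Σ≡sum (λ i → f i j))) ⟨
    Σ⟨ (λ j → Σ⟨ (λ i → f i j) ⟩) ⟩    ∎
    where open ≈-Reasoning

  Σ-≈0 : ∀ {n} {f : Fin n → Carrier} → (∀ i → f i ≈ 0#) → Σ⟨ f ⟩ ≈ 0#
  Σ-≈0 {n} f≈0 = trans (Σ-cong f≈0) (Σ-zero n)

  -‿distrib-Σ : ∀ {n} (f : Fin n → Carrier) → - Σ⟨ f ⟩ ≈ Σ⟨ (λ i → - f i) ⟩
  -‿distrib-Σ {zero}  f = ε⁻¹≈ε
  -‿distrib-Σ {suc n} f = trans (sym (⁻¹-∙-comm _ _)) (+-congˡ (-‿distrib-Σ (f ∘ Fin.suc)))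

  Σ-↑ˡ+↑ʳ : ∀ {n m} (f : Fin (n +ℕ m) → Carrier) →
    Σ⟨ f ⟩ ≈ Σ⟨ (λ a → f (a ↑ˡ m)) ⟩ + Σ⟨ (λ b → f (n ↑ʳ b)) ⟩
  Σ-↑ˡ+↑ʳ {zero}      f = sym (+-identityˡ _)
  Σ-↑ˡ+↑ʳ {suc n} {m} f = trans (+-congˡ (Σ-↑ˡ+↑ʳ {n} {m} (f ∘ Fin.suc))) (sym (+-assoc _ _ _))

  Σ-++ : ∀ {n m} (f : Fin n → Carrier) (g : Fin m → Carrier) → Σ⟨ f VF.++ g ⟩ ≈ Σ⟨ f ⟩ + Σ⟨ g ⟩
  Σ-++ {n} {m} f g = trans (Σ-↑ˡ+↑ʳ {n} {m} (f VF.++ g))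
    (+-cong (Σ-cong (reflexive ∘ VF.lookup-++ˡ f g)) (Σ-cong (reflexive ∘ VF.lookup-++ʳ f g)))

  Σ-*-≡0 : ∀ {n} (w f : Fin n → Carrier) → (∀ i → f i ≡ 0#) → Σ⟨ (λ i → w i * f i) ⟩ ≈ 0#
  Σ-*-≡0 w f f≡0 = Σ-≈0 (λ i → trans (*-congˡ (reflexive (f≡0 i))) (zeroʳ (w i)))

  Σ-nonneg : ∀ {n} {f : Fin n → Carrier} → (∀ i → 0# ≤ f i) → 0# ≤ Σ⟨ f ⟩
  Σ-nonneg {zero}  f≥0 = inj₂ refl
  Σ-nonneg {suc n} f≥0 = +-nonneg (f≥0 Fin.zero) (Σ-nonneg (f≥0 ∘ Fin.suc))

  Σ-pos : ∀ {n} {f : Fin (suc n) → Carrier} → (∀ i → 0# < f i) → 0# < Σ⟨ f ⟩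
  Σ-pos f>0 = +-pos (f>0 Fin.zero) (Σ-nonneg (inj₁ ∘ f>0 ∘ Fin.suc))

  term≤Σ : ∀ {n} {f : Fin n → Carrier} → (∀ i → 0# ≤ f i) → ∀ k → f k ≤ Σ⟨ f ⟩
  term≤Σ f≥0 Fin.zero    = x≤x+y (Σ-nonneg (f≥0 ∘ Fin.suc))
  term≤Σ {f = f} f≥0 (Fin.suc k) = begin
    f (Fin.suc k)                   ≤⟨ term≤Σ (f≥0 ∘ Fin.suc) k ⟩
    Σ⟨ f ∘ Fin.suc ⟩                ≤⟨ x≤x+y (f≥0 Fin.zero) ⟩
    Σ⟨ f ∘ Fin.suc ⟩ + f Fin.zero   ≈⟨ +-comm _ _ ⟩
    Σ⟨ f ⟩                          ∎
    where open ≤-Reasoning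

  δ : ∀ {n} → Fin n → Fin n → Carrier → Carrier
  δ Fin.zero    Fin.zero    x = x
  δ Fin.zero    (Fin.suc _) x = 0#
  δ (Fin.suc _) Fin.zero    x = 0#
  δ (Fin.suc k) (Fin.suc i) x = δ k i x

  Σ-δ : ∀ {n} (k : Fin n) (f : Fin n → Carrier) → Σ⟨ (λ i → δ k i (f i)) ⟩ ≈ f k
  Σ-δ {suc n} Fin.zero    f = trans (+-congˡ (Σ-zero n)) (+-identityʳ _)
  Σ-δ {suc n} (Fin.suc k) f = trans (+-identityˡ _) (Σ-δ k (f ∘ Fin.suc))

  δ-sym : ∀ {n} (k i : Fin n) x → δ k i x ≡ δ i k x
  δ-sym Fin.zero    Fin.zero    x = ≡.refl
  δ-sym Fin.zero    (Fin.suc i) x = ≡.refl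
  δ-sym (Fin.suc k) Fin.zero    x = ≡.refl
  δ-sym (Fin.suc k) (Fin.suc i) x = δ-sym k i x

  δ-*ʳ : ∀ {n} (k i : Fin n) x (f : Fin n → Carrier) → δ k i x * f i ≈ δ k i (x * f k)
  δ-*ʳ Fin.zero    Fin.zero    x f = refl
  δ-*ʳ Fin.zero    (Fin.suc i) x f = zeroˡ _
  δ-*ʳ (Fin.suc k) Fin.zero    x f = zeroˡ _
  δ-*ʳ (Fin.suc k) (Fin.suc i) x f = δ-*ʳ k i x (f ∘ Fin.suc)

  δ-diag : ∀ {n} (k : Fin n) x → δ k k x ≡ x
  δ-diag Fin.zero    x = ≡.refl
  δ-diag (Fin.suc k) x = δ-diag k x

  δ-off : ∀ {n} {k i : Fin n} x → k ≢ i → δ k i x ≡ 0#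
  δ-off {k = Fin.zero}  {Fin.zero}  x k≢i = ⊥-elim (k≢i ≡.refl)
  δ-off {k = Fin.zero}  {Fin.suc i} x k≢i = ≡.refl
  δ-off {k = Fin.suc k} {Fin.zero}  x k≢i = ≡.refl
  δ-off {k = Fin.suc k} {Fin.suc i} x k≢i = δ-off x (k≢i ∘ ≡.cong Fin.suc)

  δ-injective : ∀ {r n} {ι : Fin r → Fin n} → Injective _≡_ _≡_ ι → ∀ k i x → δ (ι k) (ι i) x ≡ δ k i x
  δ-injective {ι = ι} ι-inj k i x with k Fin.≟ i
  ... | yes ≡.refl = ≡.trans (δ-diag (ι k) x) (≡.sym (δ-diag k x))
  ... | no  k≢i    = ≡.trans (δ-off x (k≢i ∘ ι-inj)) (≡.sym (δ-off x k≢i))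

  AffinelyIndependent-cong : ∀ {k r} {P Q : Fin r → Point k} →
    (∀ j → P j ≈ᵖ Q j) → AffinelyIndependent P → AffinelyIndependent Q
  AffinelyIndependent-cong P≈Q P-indep λ′ Σλ′≈0 Σλ′Q≈0 =
    P-indep λ′ Σλ′≈0 (λ t → trans (Σ-cong (λ j → *-congˡ (P≈Q j t))) (Σλ′Q≈0 t))

  AffinelyIndependent-∘ : ∀ {k r s} (P : Fin r → Point k) {ι : Fin s → Fin r} →
    Injective _≡_ _≡_ ι → AffinelyIndependent P → AffinelyIndependent (P ∘ ι)
  AffinelyIndependent-∘ {r = r} {s} P {ι} ι-inj P-indep λ′ Σλ′≈0 Σλ′P∘ι≈0 j = begin
    λ′ j                            ≈⟨ Σ-δ j λ′ ⟨
    Σ⟨ (λ j′ → δ j j′ (λ′ j′)) ⟩    ≈⟨ Σ-cong (λ j′ → reflexive (≡.trans (δ-sym j j′ _) (≡.sym (δ-injective ι-inj j′ j _)))) ⟩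
    L (ι j)                         ≈⟨ P-indep L ΣL≈0 ΣLP≈0 (ι j) ⟩
    0#                              ∎
    where
    open ≈-Reasoning
    -- λ′ pushed forward along ι
    L : Fin r → Carrier
    L i = Σ⟨ (λ j′ → δ (ι j′) i (λ′ j′)) ⟩
    ΣL≈0 : Σ⟨ L ⟩ ≈ 0#
    ΣL≈0 = trans (Σ-comm (λ i j′ → δ (ι j′) i (λ′ j′)))
                 (trans (Σ-cong (λ j′ → Σ-δ (ι j′) (λ _ → λ′ j′))) Σλ′≈0)
    ΣLP≈0 : ∀ t → Σ⟨ (λ i → L i * P i t) ⟩ ≈ 0#
    ΣLP≈0 t = begin
      Σ⟨ (λ i → L i * P i t) ⟩
        ≈⟨ Σ-cong (λ i → *-distribʳ-Σ (P i t) (λ j′ → δ (ι j′) i (λ′ j′))) ⟩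
      Σ⟨ (λ i → Σ⟨ (λ j′ → δ (ι j′) i (λ′ j′) * P i t) ⟩) ⟩
        ≈⟨ Σ-cong (λ i → Σ-cong (λ j′ → δ-*ʳ (ι j′) i (λ′ j′) (λ i → P i t))) ⟩
      Σ⟨ (λ i → Σ⟨ (λ j′ → δ (ι j′) i (λ′ j′ * P (ι j′) t)) ⟩) ⟩
        ≈⟨ Σ-comm (λ i j′ → δ (ι j′) i (λ′ j′ * P (ι j′) t)) ⟩
      Σ⟨ (λ j′ → Σ⟨ (λ i → δ (ι j′) i (λ′ j′ * P (ι j′) t)) ⟩) ⟩
        ≈⟨ Σ-cong (λ j′ → Σ-δ (ι j′) (λ _ → λ′ j′ * P (ι j′) t)) ⟩
      Σ⟨ (λ j′ → λ′ j′ * P (ι j′) t) ⟩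
        ≈⟨ Σλ′P∘ι≈0 t ⟩
      0#                                                          ∎

  combination : ∀ {k n} → Config k n → (Fin n → Carrier) → Point k
  combination A w t = Σ⟨ (λ i → w i * A i t) ⟩

  combination-cong : ∀ {k n} (A : Config k n) {w v : Fin n → Carrier} →
    (∀ i → w i ≈ v i) → combination A w ≈ᵖ combination A v
  combination-cong A w≈v t = Σ-cong (λ i → *-congʳ (w≈v i))

  combination-*ˡ : ∀ {k n} (A : Config k n) r (w : Fin n → Carrier) →
    combination A (λ i → r * w i) ≈ᵖ (λ t → r * combination A w t)
  combination-*ˡ A r w t =
    trans (Σ-cong (λ i → *-assoc r (w i) (A i t))) (sym (*-distribˡ-Σ r (λ i → w i * A i t)))

  combination-+ : ∀ {k n} (A : Config k n) (w v : Fin n → Carrier) →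
    combination A (λ i → w i + v i) ≈ᵖ (λ t → combination A w t + combination A v t)
  combination-+ A w v t =
    trans (Σ-cong (λ i → distribʳ (A i t) (w i) (v i))) (Σ-distrib-+ (λ i → w i * A i t) (λ i → v i * A i t))

  beyond : Carrier → Carrier → Carrier → Carrier
  beyond μ x y = x + μ * (x + - y)

  beyond-cong : ∀ μ {x x′ y y′} → x ≈ x′ → y ≈ y′ → beyond μ x y ≈ beyond μ x′ y′
  beyond-cong μ x≈x′ y≈y′ = +-cong x≈x′ (*-congˡ (+-cong x≈x′ (-‿cong y≈y′)))

  beyond-self : ∀ μ x → beyond μ x x ≈ x
  beyond-self μ x = trans (+-congˡ (trans (*-congˡ (-‿inverseʳ x)) (zeroʳ μ))) (+-identityʳ x)

  beyond-*ʳ : ∀ μ x y z → beyond μ x y * z ≈ beyond μ (x * z) (y * z)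
  beyond-*ʳ μ x y z =
    trans (solve 4 (λ μ x -y z → ((x :+ μ :* (x :+ -y)) :* z) := (x :* z :+ μ :* (x :* z :+ -y :* z))) refl μ x (- y) z)
          (+-congˡ (*-congˡ (+-congˡ (sym (-‿distribˡ-* y z)))))

  Σ-beyond : ∀ {n} μ (f g : Fin n → Carrier) → Σ⟨ (λ i → beyond μ (f i) (g i)) ⟩ ≈ beyond μ Σ⟨ f ⟩ Σ⟨ g ⟩
  Σ-beyond μ f g = begin
    Σ⟨ (λ i → f i + μ * (f i + - g i)) ⟩        ≈⟨ Σ-distrib-+ f (λ i → μ * (f i + - g i)) ⟩
    Σ⟨ f ⟩ + Σ⟨ (λ i → μ * (f i + - g i)) ⟩     ≈⟨ +-congˡ (*-distribˡ-Σ μ (λ i → f i + - g i)) ⟨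
    Σ⟨ f ⟩ + μ * Σ⟨ (λ i → f i + - g i) ⟩       ≈⟨ +-congˡ (*-congˡ (Σ-distrib-+ f (λ i → - g i))) ⟩
    Σ⟨ f ⟩ + μ * (Σ⟨ f ⟩ + Σ⟨ (λ i → - g i) ⟩)  ≈⟨ +-congˡ (*-congˡ (+-congˡ (-‿distrib-Σ g))) ⟨
    Σ⟨ f ⟩ + μ * (Σ⟨ f ⟩ + - Σ⟨ g ⟩)            ∎
    where open ≈-Reasoning

  combination-beyond : ∀ {k n} (A : Config k n) μ (w v : Fin n → Carrier) →
    combination A (λ i → beyond μ (w i) (v i)) ≈ᵖ (λ t → beyond μ (combination A w t) (combination A v t))
  combination-beyond A μ w v t =
    trans (Σ-cong (λ i → beyond-*ʳ μ (w i) (v i) (A i t))) (Σ-beyond μ (λ i → w i * A i t) (λ i → v i * A i t))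

  minimum : ∀ {n} → (Fin (suc n) → Carrier) → Carrier
  minimum {zero}  f = f Fin.zero
  minimum {suc n} f with trichotomy (f Fin.zero) (minimum (f ∘ Fin.suc))
  ... | inj₁ _ = f Fin.zero
  ... | inj₂ _ = minimum (f ∘ Fin.suc)

  minimum-pos : ∀ {n} {f : Fin (suc n) → Carrier} → (∀ i → 0# < f i) → 0# < minimum f
  minimum-pos {zero}  f>0 = f>0 Fin.zero
  minimum-pos {suc n} {f} f>0 with trichotomy (f Fin.zero) (minimum (f ∘ Fin.suc))
  ... | inj₁ _ = f>0 Fin.zero
  ... | inj₂ _ = minimum-pos (f>0 ∘ Fin.suc)

  minimum≤ : ∀ {n} (f : Fin (suc n) → Carrier) i → minimum f ≤ f i
  minimum≤ {zero}  f Fin.zero = inj₂ refl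
  minimum≤ {suc n} f i with trichotomy (f Fin.zero) (minimum (f ∘ Fin.suc)) | i
  ... | inj₁ _             | Fin.zero  = inj₂ refl
  ... | inj₁ f₀<min        | Fin.suc i = begin
    f Fin.zero               <⟨ f₀<min ⟩
    minimum (f ∘ Fin.suc)    ≤⟨ minimum≤ (f ∘ Fin.suc) i ⟩
    f (Fin.suc i)            ∎
    where open ≤-Reasoning
  ... | inj₂ (inj₁ f₀≈min) | Fin.zero  = inj₂ (sym f₀≈min)
  ... | inj₂ (inj₂ min<f₀) | Fin.zero  = inj₁ min<f₀
  ... | inj₂ _             | Fin.suc i = minimum≤ (f ∘ Fin.suc) i

  record PositiveCombination {k n} (A : Config k n) (x : Point k) : Set (c ⊔ ℓ₁ ⊔ ℓ₂) where
    constructor positiveCombination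
    field
      weight      : Fin n → Carrier
      weight>0    : ∀ i → 0# < weight i
      Σweight≈1   : Σ⟨ weight ⟩ ≈ 1#
      x≈combination : x ≈ᵖ combination A weight

  positive⇒InRelint : ∀ {k n} {A : Config k (suc n)} {x} → PositiveCombination A x → InRelint A x
  positive⇒InRelint {n = n} {A} {x} (positiveCombination w w>0 Σw≈1 x≈) =
    (w , inj₁ ∘ w>0 , (λ _ i∉⊤ → ⊥-elim (i∉⊤ ∈⊤)) , Σw≈1 , x≈) , extend
    where
    μ = minimum w
    extend : ∀ y → InConv A y → Σ Carrier λ μ → 0# < μ × InConv A (λ t → beyond μ (x t) (y t))
    extend y (v , v≥0 , _ , Σv≈1 , y≈) =
      μ , minimum-pos w>0 , w′ , w′≥0 , (λ _ i∉⊤ → ⊥-elim (i∉⊤ ∈⊤)) , Σw′≈1 , beyond≈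
      where
      w′ : Fin (suc n) → Carrier
      w′ i = beyond μ (w i) (v i)
      w′≥0 : ∀ i → 0# ≤ w′ i
      w′≥0 i = ≤-respʳ-≈ rearrange (x≤y⇒0≤y-x μvᵢ≤wᵢ+μwᵢ)
        where
        open ≤-Reasoning
        μ≥0 = inj₁ (minimum-pos w>0)
        μvᵢ≤wᵢ+μwᵢ : μ * v i ≤ w i + μ * w i
        μvᵢ≤wᵢ+μwᵢ = begin
          μ * v i          ≤⟨ *-monoˡ-≤ μ≥0 (≤-respʳ-≈ Σv≈1 (term≤Σ v≥0 i)) ⟩
          μ * 1#           ≈⟨ *-identityʳ μ ⟩
          μ                ≤⟨ minimum≤ w i ⟩
          w i              ≤⟨ x≤x+y (*-nonneg μ≥0 (inj₁ (w>0 i))) ⟩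
          w i + μ * w i    ∎
        rearrange : w i + μ * w i + - (μ * v i) ≈ w′ i
        rearrange = sym (trans
          (solve 3 (λ μ w -v → (w :+ μ :* (w :+ -v)) := (w :+ μ :* w :+ μ :* -v)) refl μ (w i) (- v i))
          (+-congˡ (sym (-‿distribʳ-* μ (v i)))))
      Σw′≈1 : Σ⟨ w′ ⟩ ≈ 1#
      Σw′≈1 = trans (Σ-beyond μ w v) (trans (beyond-cong μ Σw≈1 Σv≈1) (beyond-self μ 1#))
      beyond≈ : (λ t → beyond μ (x t) (y t)) ≈ᵖ combination A w′
      beyond≈ t = sym (trans (combination-beyond A μ w v t) (beyond-cong μ (sym (x≈ t)) (sym (y≈ t))))

  positive-weights : ∀ n → ∃ λ (β : Fin (suc n) → Carrier) → (∀ i → 0# < β i) × Σ⟨ β ⟩ ≈ 1#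
  positive-weights n with inverse-pos (Σ-pos {f = λ (_ : Fin (suc n)) → 1#} (λ _ → 0<1))
  ... | r , Σ1*r≈1 , r>0 = (λ _ → r) , (λ _ → r>0) , (begin
    Σ⟨ (λ (_ : Fin (suc n)) → r) ⟩         ≈⟨ Σ-cong {suc n} (λ _ → *-identityʳ r) ⟨
    Σ⟨ (λ (_ : Fin (suc n)) → r * 1#) ⟩    ≈⟨ *-distribˡ-Σ {suc n} r (λ _ → 1#) ⟨
    r * Σ⟨ (λ (_ : Fin (suc n)) → 1#) ⟩    ≈⟨ *-comm r _ ⟩
    Σ⟨ (λ (_ : Fin (suc n)) → 1#) ⟩ * r    ≈⟨ Σ1*r≈1 ⟩
    1#                                     ∎)
    where open ≈-Reasoning

  μb+beyond≈[1+μ]x : ∀ μ x b → μ * b + beyond μ x b ≈ (1# + μ) * x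
  μb+beyond≈[1+μ]x μ x b = begin
    μ * b + (x + μ * (x + - b))       ≈⟨ solve 4 (λ μ x b -b → (μ :* b :+ (x :+ μ :* (x :+ -b)))
                                                   := ((con 1 :+ μ) :* x :+ μ :* (b :+ -b))) refl μ x b (- b) ⟩
    (1# + μ) * x + μ * (b + - b)      ≈⟨ +-congˡ (trans (*-congˡ (-‿inverseʳ b)) (zeroʳ μ)) ⟩
    (1# + μ) * x + 0#                 ≈⟨ +-identityʳ _ ⟩
    (1# + μ) * x                      ∎
    where open ≈-Reasoning

  -- Extending the segment from a point b with positive weights beyond x stays in conv A, which
  -- writes x as a strict convex combination of b and a point of conv A.
  InRelint⇒positive : ∀ {k n} {A : Config k (suc n)} {x} → InRelint A x → PositiveCombination A x
  InRelint⇒positive {n = n} {A} {x} (_ , extend) with positive-weights n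
  ... | β , β>0 , Σβ≈1
    with extend (combination A β) (β , inj₁ ∘ β>0 , (λ _ i∉⊤ → ⊥-elim (i∉⊤ ∈⊤)) , Σβ≈1 , λ _ → refl)
  ... | μ , μ>0 , ω , ω≥0 , _ , Σω≈1 , beyond≈ω with inverse-pos (+-pos 0<1 (inj₁ μ>0))
  ... | r , [1+μ]r≈1 , r>0 = positiveCombination u u>0 Σu≈1 x≈
    where
    open ≈-Reasoning
    b = combination A β
    u : Fin (suc n) → Carrier
    u i = r * (μ * β i + ω i)
    u>0 : ∀ i → 0# < u i
    u>0 i = *-pos r>0 (+-pos (*-pos μ>0 (β>0 i)) (ω≥0 i))
    r[1+μ]≈1 : r * (1# + μ) ≈ 1#
    r[1+μ]≈1 = trans (*-comm r _) [1+μ]r≈1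
    Σu≈1 : Σ⟨ u ⟩ ≈ 1#
    Σu≈1 = begin
      Σ⟨ u ⟩                                  ≈⟨ *-distribˡ-Σ r (λ i → μ * β i + ω i) ⟨
      r * Σ⟨ (λ i → μ * β i + ω i) ⟩          ≈⟨ *-congˡ (Σ-distrib-+ (λ i → μ * β i) ω) ⟩
      r * (Σ⟨ (λ i → μ * β i) ⟩ + Σ⟨ ω ⟩)     ≈⟨ *-congˡ (+-congʳ (*-distribˡ-Σ μ β)) ⟨
      r * (μ * Σ⟨ β ⟩ + Σ⟨ ω ⟩)               ≈⟨ *-congˡ (+-cong (trans (*-congˡ Σβ≈1) (*-identityʳ μ)) Σω≈1) ⟩
      r * (μ + 1#)                            ≈⟨ trans (*-congˡ (+-comm μ 1#)) r[1+μ]≈1 ⟩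
      1#                                      ∎
    x≈ : x ≈ᵖ combination A u
    x≈ t = sym (begin
      combination A u t                                ≈⟨ combination-*ˡ A r (λ i → μ * β i + ω i) t ⟩
      r * combination A (λ i → μ * β i + ω i) t        ≈⟨ *-congˡ (combination-+ A (λ i → μ * β i) ω t) ⟩
      r * (combination A (λ i → μ * β i) t + combination A ω t)
                                                       ≈⟨ *-congˡ (+-cong (combination-*ˡ A μ β t) (sym (beyond≈ω t))) ⟩
      r * (μ * b t + beyond μ (x t) (b t))             ≈⟨ *-congˡ (μb+beyond≈[1+μ]x μ (x t) (b t)) ⟩
      r * ((1# + μ) * x t)                             ≈⟨ *-assoc r _ (x t) ⟨
      r * (1# + μ) * x t                               ≈⟨ trans (*-congʳ r[1+μ]≈1) (*-identityˡ (x t)) ⟩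
      x t                                              ∎)

  record RelintWeights {k n} (A : Config k n) (S : Subset n) : Set (c ⊔ ℓ₁ ⊔ ℓ₂) where
    constructor relintWeights
    field
      w       : Fin n → Carrier
      w≥0     : ∀ i → 0# ≤ w i
      w-on-S  : ∀ i → i ∉ S → w i ≈ 0#
      p       : Fin n → Carrier
      p>0     : ∀ i → 0# < p i
      Σw≈Σp   : Σ⟨ w ⟩ ≈ Σ⟨ p ⟩
      w≈p     : combination A w ≈ᵖ combination A p

  MeetsRelint⇒RelintWeights : ∀ {k n} {A : Config k (suc n)} {S} → MeetsRelint A S → RelintWeights A S
  MeetsRelint⇒RelintWeights {A = A} (x , (w , w≥0 , w-on-S , Σw≈1 , x≈w) , x∈relint) =
    relintWeights w w≥0 w-on-S p p>0 (trans Σw≈1 (sym Σp≈1)) (λ t → trans (sym (x≈w t)) (x≈p t))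
    where
    open PositiveCombination (InRelint⇒positive {A = A} x∈relint)
      renaming (weight to p; weight>0 to p>0; Σweight≈1 to Σp≈1; x≈combination to x≈p)

  RelintWeights⇒MeetsRelint : ∀ {k n} {A : Config k (suc n)} {S} → RelintWeights A S → MeetsRelint A S
  RelintWeights⇒MeetsRelint {A = A} (relintWeights w w≥0 w-on-S p p>0 Σw≈Σp w≈p)
    with inverse-pos (Σ-pos p>0)
  ... | r , Σp*r≈1 , r>0 =
    combination A rw ,
    (rw , (λ i → *-nonneg (inj₁ r>0) (w≥0 i)) , (λ i i∉S → trans (*-congˡ (w-on-S i i∉S)) (zeroʳ r)) ,
      Σrw≈1 , (λ _ → refl)) ,
    positive⇒InRelint {A = A} (positiveCombination rp (λ i → *-pos r>0 (p>0 i)) Σrp≈1 rw≈rp)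
    where
    rw = λ i → r * w i
    rp = λ i → r * p i
    r*Σp≈1 : r * Σ⟨ p ⟩ ≈ 1#
    r*Σp≈1 = trans (*-comm r _) Σp*r≈1
    Σrw≈1 : Σ⟨ rw ⟩ ≈ 1#
    Σrw≈1 = trans (sym (*-distribˡ-Σ r w)) (trans (*-congˡ Σw≈Σp) r*Σp≈1)
    Σrp≈1 : Σ⟨ rp ⟩ ≈ 1#
    Σrp≈1 = trans (sym (*-distribˡ-Σ r p)) r*Σp≈1
    rw≈rp : combination A rw ≈ᵖ combination A rp
    rw≈rp t = trans (combination-*ˡ A r w t) (trans (*-congˡ (w≈p t)) (sym (combination-*ˡ A r p t)))

  module _ {k l n m} (A : Config k n) (B : Config l m) where

    left : Fin k → Fin (k +ℕ l +ℕ 1)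
    left u = (u ↑ˡ l) ↑ˡ 1

    right : Fin l → Fin (k +ℕ l +ℕ 1)
    right v = (k ↑ʳ v) ↑ˡ 1

    height : Fin (k +ℕ l +ℕ 1)
    height = (k +ℕ l) ↑ʳ Fin.zero

    ≈ᵖ-by-coordinates : ∀ {x y : Point (k +ℕ l +ℕ 1)} → (∀ u → x (left u) ≈ y (left u)) →
      (∀ v → x (right v) ≈ y (right v)) → x height ≈ y height → x ≈ᵖ y
    ≈ᵖ-by-coordinates x≈yˡ x≈yʳ x≈yʰ t with ↑ˡ⊎↑ʳ {k +ℕ l} {1} t
    ... | inj₂ (Fin.zero , ≡.refl) = x≈yʰ
    ... | inj₁ (s , ≡.refl) with ↑ˡ⊎↑ʳ {k} {l} s
    ...   | inj₁ (u , ≡.refl) = x≈yˡ u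
    ...   | inj₂ (v , ≡.refl) = x≈yʳ v

    join-↑ˡ-left : ∀ a u → join A B (a ↑ˡ m) (left u) ≡ A a u
    join-↑ˡ-left a u
      rewrite Fin.splitAt-↑ˡ n a m | Fin.splitAt-↑ˡ (k +ℕ l) (u ↑ˡ l) 1 | Fin.splitAt-↑ˡ k u l = ≡.refl

    join-↑ˡ-right : ∀ a v → join A B (a ↑ˡ m) (right v) ≡ 0#
    join-↑ˡ-right a v
      rewrite Fin.splitAt-↑ˡ n a m | Fin.splitAt-↑ˡ (k +ℕ l) (k ↑ʳ v) 1 | Fin.splitAt-↑ʳ k l v = ≡.refl

    join-↑ˡ-height : ∀ a → join A B (a ↑ˡ m) height ≡ 0#
    join-↑ˡ-height a rewrite Fin.splitAt-↑ˡ n a m | Fin.splitAt-↑ʳ (k +ℕ l) 1 Fin.zero = ≡.refl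

    join-↑ʳ-left : ∀ b u → join A B (n ↑ʳ b) (left u) ≡ 0#
    join-↑ʳ-left b u
      rewrite Fin.splitAt-↑ʳ n m b | Fin.splitAt-↑ˡ (k +ℕ l) (u ↑ˡ l) 1 | Fin.splitAt-↑ˡ k u l = ≡.refl

    join-↑ʳ-right : ∀ b v → join A B (n ↑ʳ b) (right v) ≡ B b v
    join-↑ʳ-right b v
      rewrite Fin.splitAt-↑ʳ n m b | Fin.splitAt-↑ˡ (k +ℕ l) (k ↑ʳ v) 1 | Fin.splitAt-↑ʳ k l v = ≡.refl

    join-↑ʳ-height : ∀ b → join A B (n ↑ʳ b) height ≡ 1#
    join-↑ʳ-height b rewrite Fin.splitAt-↑ʳ n m b | Fin.splitAt-↑ʳ (k +ℕ l) 1 Fin.zero = ≡.refl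

    combination-join-left : ∀ w u → combination (join A B) w (left u) ≈ combination A (w ∘ (_↑ˡ m)) u
    combination-join-left w u = trans (Σ-↑ˡ+↑ʳ {n} {m} (λ i → w i * join A B i (left u)))
      (trans (+-cong (Σ-cong (λ a → *-congˡ (reflexive (join-↑ˡ-left a u))))
                     (Σ-*-≡0 (w ∘ (n ↑ʳ_)) _ (λ b → join-↑ʳ-left b u)))
             (+-identityʳ _))

    combination-join-right : ∀ w v → combination (join A B) w (right v) ≈ combination B (w ∘ (n ↑ʳ_)) v
    combination-join-right w v = trans (Σ-↑ˡ+↑ʳ {n} {m} (λ i → w i * join A B i (right v)))
      (trans (+-cong (Σ-*-≡0 (w ∘ (_↑ˡ m)) _ (λ a → join-↑ˡ-right a v))
                     (Σ-cong (λ b → *-congˡ (reflexive (join-↑ʳ-right b v)))))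
             (+-identityˡ _))

    combination-join-height : ∀ w → combination (join A B) w height ≈ Σ⟨ w ∘ (n ↑ʳ_) ⟩
    combination-join-height w = trans (Σ-↑ˡ+↑ʳ {n} {m} (λ i → w i * join A B i height))
      (trans (+-cong (Σ-*-≡0 (w ∘ (_↑ˡ m)) _ join-↑ˡ-height)
                     (Σ-cong (λ b → trans (*-congˡ (reflexive (join-↑ʳ-height b))) (*-identityʳ _))))
             (+-identityˡ _))

    combination-join-left-++ : ∀ (f : Fin n → Carrier) g u →
      combination (join A B) (f VF.++ g) (left u) ≈ combination A f u
    combination-join-left-++ f g u =
      trans (combination-join-left (f VF.++ g) u) (combination-cong A (reflexive ∘ VF.lookup-++ˡ f g) u)

    combination-join-right-++ : ∀ (f : Fin n → Carrier) g v →
      combination (join A B) (f VF.++ g) (right v) ≈ combination B g v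
    combination-join-right-++ f g v =
      trans (combination-join-right (f VF.++ g) v) (combination-cong B (reflexive ∘ VF.lookup-++ʳ f g) v)

    combination-join-height-++ : ∀ (f : Fin n → Carrier) g → combination (join A B) (f VF.++ g) height ≈ Σ⟨ g ⟩
    combination-join-height-++ f g =
      trans (combination-join-height (f VF.++ g)) (Σ-cong (reflexive ∘ VF.lookup-++ʳ f g))

    AffinelyIndependent-join : AffinelyIndependent A → AffinelyIndependent B → AffinelyIndependent (join A B)
    AffinelyIndependent-join A-indep B-indep λ′ Σλ′≈0 λ′J≈0 = λ′≈0
      where
      λA = λ′ ∘ (_↑ˡ m)
      λB = λ′ ∘ (n ↑ʳ_)
      ΣλB≈0 : Σ⟨ λB ⟩ ≈ 0#
      ΣλB≈0 = trans (sym (combination-join-height λ′)) (λ′J≈0 height)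
      ΣλA≈0 : Σ⟨ λA ⟩ ≈ 0#
      ΣλA≈0 = ∙-cancelʳ Σ⟨ λB ⟩ _ _
        (trans (sym (Σ-↑ˡ+↑ʳ {n} {m} λ′)) (trans Σλ′≈0 (sym (trans (+-congˡ ΣλB≈0) (+-identityˡ 0#)))))
      λ′≈0 : ∀ j → λ′ j ≈ 0#
      λ′≈0 j with ↑ˡ⊎↑ʳ {n} {m} j
      ... | inj₁ (a , ≡.refl) = A-indep λA ΣλA≈0 (λ u → trans (sym (combination-join-left λ′ u)) (λ′J≈0 (left u))) a
      ... | inj₂ (b , ≡.refl) = B-indep λB ΣλB≈0 (λ v → trans (sym (combination-join-right λ′ v)) (λ′J≈0 (right v))) b

    AffinelyIndependent-join⁻ˡ : ∀ {r} (xs : Fin r → Fin n) →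
      AffinelyIndependent (λ j → join A B (xs j ↑ˡ m)) → AffinelyIndependent (A ∘ xs)
    AffinelyIndependent-join⁻ˡ xs indep λ′ Σλ′≈0 λ′A≈0 = indep λ′ Σλ′≈0 (≈ᵖ-by-coordinates
      (λ u → trans (Σ-cong (λ j → *-congˡ (reflexive (join-↑ˡ-left (xs j) u)))) (λ′A≈0 u))
      (λ v → Σ-*-≡0 λ′ _ (λ j → join-↑ˡ-right (xs j) v))
      (Σ-*-≡0 λ′ _ (λ j → join-↑ˡ-height (xs j))))

    AffinelyIndependent-join⁻ʳ : ∀ {r} (ys : Fin r → Fin m) →
      AffinelyIndependent (λ j → join A B (n ↑ʳ ys j)) → AffinelyIndependent (B ∘ ys)
    AffinelyIndependent-join⁻ʳ ys indep λ′ Σλ′≈0 λ′B≈0 = indep λ′ Σλ′≈0 (≈ᵖ-by-coordinates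
      (λ u → Σ-*-≡0 λ′ _ (λ j → join-↑ʳ-left (ys j) u))
      (λ v → trans (Σ-cong (λ j → *-congˡ (reflexive (join-↑ʳ-right (ys j) v)))) (λ′B≈0 v))
      (trans (Σ-cong (λ j → trans (*-congˡ (reflexive (join-↑ʳ-height (ys j)))) (*-identityʳ _))) Σλ′≈0))

    RelintWeights-join : ∀ {SA SB} → RelintWeights A SA → RelintWeights B SB → RelintWeights (join A B) (SA ++ SB)
    RelintWeights-join {SA} {SB} (relintWeights wA wA≥0 wA-on-SA pA pA>0 ΣwA≈ΣpA wA≈pA)
                                 (relintWeights wB wB≥0 wB-on-SB pB pB>0 ΣwB≈ΣpB wB≈pB) =
      relintWeights w (++⁺ (0# ≤_) wA≥0 wB≥0) w-on-S p (++⁺ (0# <_) pA>0 pB>0) Σw≈Σp w≈p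
      where
      w = wA VF.++ wB
      p = pA VF.++ pB
      w-on-S : ∀ i → i ∉ SA ++ SB → w i ≈ 0#
      w-on-S i i∉S with ↑ˡ⊎↑ʳ {n} {m} i
      ... | inj₁ (a , ≡.refl) = trans (reflexive (VF.lookup-++ˡ wA wB a)) (wA-on-SA a (i∉S ∘ x∈p⇒x↑ˡ∈p++q SA SB))
      ... | inj₂ (b , ≡.refl) = trans (reflexive (VF.lookup-++ʳ wA wB b)) (wB-on-SB b (i∉S ∘ y∈q⇒n↑ʳy∈p++q SA SB))
      Σw≈Σp : Σ⟨ w ⟩ ≈ Σ⟨ p ⟩
      Σw≈Σp = trans (Σ-++ wA wB) (trans (+-cong ΣwA≈ΣpA ΣwB≈ΣpB) (sym (Σ-++ pA pB)))
      w≈p : combination (join A B) w ≈ᵖ combination (join A B) p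
      w≈p = ≈ᵖ-by-coordinates
        (λ u → trans (combination-join-left-++ wA wB u) (trans (wA≈pA u) (sym (combination-join-left-++ pA pB u))))
        (λ v → trans (combination-join-right-++ wA wB v) (trans (wB≈pB v) (sym (combination-join-right-++ pA pB v))))
        (trans (combination-join-height-++ wA wB) (trans ΣwB≈ΣpB (sym (combination-join-height-++ pA pB))))

    RelintWeights-join⁻ : ∀ {SA SB} → RelintWeights (join A B) (SA ++ SB) → RelintWeights A SA × RelintWeights B SB
    RelintWeights-join⁻ {SA} {SB} (relintWeights w w≥0 w-on-S p p>0 Σw≈Σp w≈p) =
      relintWeights (w ∘ (_↑ˡ m)) (w≥0 ∘ (_↑ˡ m)) (λ a a∉SA → w-on-S (a ↑ˡ m) (a∉SA ∘ x↑ˡ∈p++q⇒x∈p SA SB))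
        (p ∘ (_↑ˡ m)) (p>0 ∘ (_↑ˡ m)) ΣwA≈ΣpA
        (λ u → trans (sym (combination-join-left w u)) (trans (w≈p (left u)) (combination-join-left p u))) ,
      relintWeights (w ∘ (n ↑ʳ_)) (w≥0 ∘ (n ↑ʳ_)) (λ b b∉SB → w-on-S (n ↑ʳ b) (b∉SB ∘ n↑ʳy∈p++q⇒y∈q SA SB))
        (p ∘ (n ↑ʳ_)) (p>0 ∘ (n ↑ʳ_)) ΣwB≈ΣpB
        (λ v → trans (sym (combination-join-right w v)) (trans (w≈p (right v)) (combination-join-right p v)))
      where
      ΣwB≈ΣpB : Σ⟨ w ∘ (n ↑ʳ_) ⟩ ≈ Σ⟨ p ∘ (n ↑ʳ_) ⟩
      ΣwB≈ΣpB = trans (sym (combination-join-height w)) (trans (w≈p height) (combination-join-height p))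
      ΣwA≈ΣpA : Σ⟨ w ∘ (_↑ˡ m) ⟩ ≈ Σ⟨ p ∘ (_↑ˡ m) ⟩
      ΣwA≈ΣpA = ∙-cancelʳ Σ⟨ p ∘ (n ↑ʳ_) ⟩ _ _ (begin
        Σ⟨ w ∘ (_↑ˡ m) ⟩ + Σ⟨ p ∘ (n ↑ʳ_) ⟩   ≈⟨ +-congˡ ΣwB≈ΣpB ⟨
        Σ⟨ w ∘ (_↑ˡ m) ⟩ + Σ⟨ w ∘ (n ↑ʳ_) ⟩   ≈⟨ Σ-↑ˡ+↑ʳ {n} {m} w ⟨
        Σ⟨ w ⟩                                ≈⟨ Σw≈Σp ⟩
        Σ⟨ p ⟩                                ≈⟨ Σ-↑ˡ+↑ʳ {n} {m} p ⟩
        Σ⟨ p ∘ (_↑ˡ m) ⟩ + Σ⟨ p ∘ (n ↑ʳ_) ⟩   ∎)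
        where open ≈-Reasoning

  join-∘ : ∀ {k l n m r s} (A : Config k n) (B : Config l m) (f : Fin r → Fin n) (g : Fin s → Fin m) →
    ∀ j t → join A B (((λ a → f a ↑ˡ m) VF.++ (λ b → n ↑ʳ g b)) j) t ≡ join (A ∘ f) (B ∘ g) j t
  join-∘ {k} {l} {n} {m} {r} A B f g j t with splitAt r j
  ... | inj₁ a rewrite Fin.splitAt-↑ˡ n (f a) m with splitAt (k +ℕ l) t
  ...   | inj₂ _ = ≡.refl
  ...   | inj₁ s with splitAt k s
  ...     | inj₁ _ = ≡.refl
  ...     | inj₂ _ = ≡.refl
  join-∘ {k} {l} {n} {m} {r} A B f g j t | inj₂ b rewrite Fin.splitAt-↑ʳ n m (g b) with splitAt (k +ℕ l) t
  ...   | inj₂ _ = ≡.refl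
  ...   | inj₁ s with splitAt k s
  ...     | inj₁ _ = ≡.refl
  ...     | inj₂ _ = ≡.refl

  independent-size< : ∀ {k n r s} (A : Config k n) (f : Fin r → Fin n) → AffinelyIndependent (A ∘ f) →
    (∀ (g : Fin s → Fin n) → ¬ AffinelyIndependent (A ∘ g)) → r ℕ.< s
  independent-size< A f f-indep no-independent = ℕ.≰⇒> λ s≤r →
    no-independent (λ i → f (Fin.inject≤ i s≤r))
      (AffinelyIndependent-∘ (A ∘ f) (λ {i} {j} → Fin.inject≤-injective s≤r s≤r i j) f-indep)

  IsDim-unique : ∀ {k n d d′} {A : Config k n} → IsDim A d → IsDim A d′ → d ≡ d′
  IsDim-unique {A = A} ((f , f-indep) , no-larger) ((f′ , f′-indep) , no-larger′) = ℕ.≤-antisym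
    (ℕ.≤-pred (ℕ.≤-pred (independent-size< A f f-indep no-larger′)))
    (ℕ.≤-pred (ℕ.≤-pred (independent-size< A f′ f′-indep no-larger)))

  isDim-join : ∀ {k l n m dA dB} {A : Config k n} {B : Config l m} →
    IsDim A dA → IsDim B dB → IsDim (join A B) (dA +ℕ suc dB)
  isDim-join {n = n} {m} {dA} {dB} {A} {B} ((fA , fA-indep) , A-no-larger) ((fB , fB-indep) , B-no-larger) =
    ((λ a → fA a ↑ˡ m) VF.++ (λ b → n ↑ʳ fB b) ,
      AffinelyIndependent-cong (λ j t → reflexive (≡.sym (join-∘ A B fA fB j t)))
        (AffinelyIndependent-join (A ∘ fA) (B ∘ fB) fA-indep fB-indep)) ,
    no-larger
    where
    join-cong : ∀ {i i′} → i′ ≡ i → join A B i ≈ᵖ join A B i′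
    join-cong ≡.refl t = refl
    no-larger : (g : Fin (suc (suc (dA +ℕ suc dB))) → Fin (n +ℕ m)) → ¬ AffinelyIndependent (join A B ∘ g)
    no-larger g g-indep with pigeonhole-⊎ (suc dA) (suc dB) (splitAt n ∘ g) ℕ.≤-refl
    ... | inj₁ (selection ι ι-inj xs g∘ι≡) = A-no-larger xs (AffinelyIndependent-join⁻ˡ A B xs
          (AffinelyIndependent-cong (join-cong ∘ Fin.splitAt⁻¹-↑ˡ ∘ g∘ι≡)
            (AffinelyIndependent-∘ (join A B ∘ g) ι-inj g-indep)))
    ... | inj₂ (selection ι ι-inj ys g∘ι≡) = B-no-larger ys (AffinelyIndependent-join⁻ʳ A B ys
          (AffinelyIndependent-cong (join-cong ∘ Fin.splitAt⁻¹-↑ʳ ∘ g∘ι≡)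
            (AffinelyIndependent-∘ (join A B ∘ g) ι-inj g-indep)))

  module _ {k l n m} (A : Config k (suc n)) (B : Config l (suc m)) where

    MeetsRelint-join⁺ : ∀ {SA SB} → MeetsRelint A SA → MeetsRelint B SB → MeetsRelint (join A B) (SA ++ SB)
    MeetsRelint-join⁺ SA-meets SB-meets = RelintWeights⇒MeetsRelint
      (RelintWeights-join A B (MeetsRelint⇒RelintWeights SA-meets) (MeetsRelint⇒RelintWeights SB-meets))

    MeetsRelint-join⁻ : ∀ {SA SB} → MeetsRelint (join A B) (SA ++ SB) → MeetsRelint A SA × MeetsRelint B SB
    MeetsRelint-join⁻ S-meets = Product.map RelintWeights⇒MeetsRelint RelintWeights⇒MeetsRelint
      (RelintWeights-join⁻ A B (MeetsRelint⇒RelintWeights S-meets))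

    isCodeg-join : ∀ {γA γB} → IsCodeg A γA → IsCodeg B γB → IsCodeg (join A B) (γA +ℕ γB)
    isCodeg-join {γA} {γB} ((SA , ∣SA∣≡γA , SA-meets) , SA-minimal) ((SB , ∣SB∣≡γB , SB-meets) , SB-minimal) =
      (SA ++ SB , ≡.trans (∣p++q∣≡∣p∣+∣q∣ SA SB) (≡.cong₂ _+ℕ_ ∣SA∣≡γA ∣SB∣≡γB) , MeetsRelint-join⁺ SA-meets SB-meets) ,
      minimal
      where
      minimal : ∀ S → MeetsRelint (join A B) S → γA +ℕ γB ℕ.≤ ∣ S ∣
      minimal S S-meets with Vec.splitAt (suc n) S
      ... | SA′ , SB′ , ≡.refl = ≡.subst (γA +ℕ γB ℕ.≤_) (≡.sym (∣p++q∣≡∣p∣+∣q∣ SA′ SB′))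
              (ℕ.+-mono-≤ (SA-minimal SA′ (proj₁ parts)) (SB-minimal SB′ (proj₂ parts)))
        where parts = MeetsRelint-join⁻ S-meets

  IsCodeg-unique : ∀ {k n γ γ′} {A : Config k n} → IsCodeg A γ → IsCodeg A γ′ → γ ≡ γ′
  IsCodeg-unique ((S , ∣S∣≡γ , S-meets) , γ-minimal) ((S′ , ∣S′∣≡γ′ , S′-meets) , γ′-minimal) = ℕ.≤-antisym
    (≡.subst (_ ℕ.≤_) ∣S′∣≡γ′ (γ-minimal S′ S′-meets))
    (≡.subst (_ ℕ.≤_) ∣S∣≡γ (γ′-minimal S S-meets))

mainTheorem20 : ∀ {c ℓ₁ ℓ₂ : Level} (F : OrderedField c ℓ₁ ℓ₂) →
    let open Geometry F in
    ∀ {p q n m : ℕ} (A : Config p (suc n)) (B : Config q (suc m))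
      (dA dB cA cB : ℕ) →
      IsDim A dA → IsDim B dB → IsCodeg A cA → IsCodeg B cB →
      IsCodeg (join A B) (cA Data.Nat.+ cB)
      × (∀ dJ cJ → IsDim (join A B) dJ → IsCodeg (join A B) cJ →
           degree dJ cJ ≡ degree dA cA +ℤ degree dB cB)
mainTheorem20 F A B dA dB cA cB dimA dimB codegA codegB =
  codegJ , λ dJ cJ dimJ codegJ′ → ≡.trans
    (≡.cong₂ degree (IsDim-unique F {A = join A B} dimJ (isDim-join F {A = A} {B} dimA dimB))
                    (IsCodeg-unique F {A = join A B} codegJ′ codegJ))
    (+[m+n]-+[k+l]≡[+m-+k]+[+n-+l] (suc dA) (suc dB) cA cB)
  where
  open Geometry F using (join; degree)
  codegJ = isCodeg-join F A B codegA codegB
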